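{- Let $V$ be a finite set with $n=|V|\ge2$, let $\pi:V\to V$ be a permutation, and let $\mathcal A,\mathcal B\subseteq V$. Then $$|\Sigma_{\pi,\mathcal A}-\Sigma_{\pi,\mathcal B}|\ \le\ \sqrt2\,\sqrt{\frac{|\mathcal A\cap\mathcal B^c|+|\mathcal A^c\cap\mathcal B|}{n}}.$$
   Context: Let $\ell^2(V)$ be the space of functions $V\to\mathbb C$ with inner product $\langle f,g\rangle=\sum_v f(v)\overline{g(v)}$. For $S\subseteq V$, $1_S$ is its indicator function and $S^c=V\setminus S$. A permutation $\pi$ acts on functions by $(\pi\cdot f)(v)=f(\pi^{ -1}v)$, so that $\pi\cdot 1_S=1_{\pi(S)}$. For $\mathscr V\subseteq V$ define $$\Sigma_{\pi,\mathscr V}:=\frac{\langle \pi\cdot1_{\mathscr V},1_{\mathscr V}\rangle+\langle\pi\cdot1_{\mathscr V^c},1_{\mathscr V^c}\rangle}{n}.$$ -}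

module Defs where

open import Data.Nat using (ℕ; NonZero)
open import Data.Bool using (true; false)
open import Data.Fin using (Fin)
open import Data.Fin.Subset using (Subset; ∁; _∩_)
open import Data.Fin.Permutation using (Permutation′; _⟨$⟩ˡ_)
open import Data.List using (map; allFin)
open import Data.Nat.ListAction using (sum)
open import Data.Vec using (lookup)
open import Data.Integer using (+_)
open import Data.Rational using (ℚ; _/_)

-- Indicator function 1_S : V → ℕ (values 0/1; real-valued, so conjugation is trivial).
𝟙 : ∀ {n} → Subset n → Fin n → ℕ
𝟙 S v with lookup S v
... | true  = 1
... | false = 0

_·_ : ∀ {n} → Permutation′ n → (Fin n → ℕ) → Fin n → ℕ
(π · f) v = f (π ⟨$⟩ˡ v)

⟨_,_⟩ : ∀ {n} → (Fin n → ℕ) → (Fin n → ℕ) → ℕ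
⟨_,_⟩ {n} f g = sum (map (λ v → f v Data.Nat.* g v) (allFin n))

Sig : ∀ {n} .{{_ : NonZero n}} → Permutation′ n → Subset n → ℚ
Sig {n} π A = (+ (⟨ π · 𝟙 A , 𝟙 A ⟩ Data.Nat.+ ⟨ π · 𝟙 (∁ A) , 𝟙 (∁ A) ⟩)) / n

-- Write nΣ_A for the number of v with v ∈ A ⇔ π⁻¹v ∈ A. Changing A into B changes the
-- agreement at v only if v or π⁻¹v lies in the symmetric difference A △ B, so
-- |nΣ_A − nΣ_B| ≤ 2|A △ B|; trivially also |nΣ_A − nΣ_B| ≤ n. Multiplying the two bounds
-- gives (Σ_A − Σ_B)² ≤ 2|A △ B|/n.
module Submission where

open import Defs
open import Data.Nat using (ℕ; NonZero; _≤_; _+_)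
open import Data.Fin.Subset using (Subset; ∁; _∩_; ∣_∣)
open import Data.Fin.Permutation using (Permutation′)
open import Data.Integer using (+_)
open import Data.Rational using (ℚ; _/_; _-_; _*_) renaming (∣_∣ to abs; _≤_ to _≤ℚ_)

open import Data.Nat as ℕ using (suc; z≤n; s≤s; _≤ᵇ_)
open import Data.Nat.Properties
  using (≤ᵇ⇒≤; ≤-total; ≤-trans; ≤-reflexive; +-mono-≤; *-mono-≤; *-comm; *-assoc; +-assoc
        ; +-identityʳ; *-identityˡ; *-monoˡ-≤; m≤n+o⇒m∸n≤o; ⊔-lub; +-0-commutativeMonoid)
open import Data.Bool using (Bool; true; false; not; _∧_; _xor_; T)
open import Data.Bool.Properties using (xor-comm)
open import Data.Unit using (tt)
open import Data.Sum using (inj₁; inj₂)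
open import Data.Fin using (Fin; zero; suc)
open import Data.Fin.Permutation using (_⟨$⟩ˡ_; flip)
open import Data.Vec using ([]; _∷_; lookup)
open import Data.Vec.Properties using (lookup-map; lookup-zipWith)
open import Data.List using (tabulate)
open import Data.List.Properties using (map-tabulate)
import Data.Nat.ListAction as List
open import Algebra.Properties.CommutativeMonoid.Sum +-0-commutativeMonoid
  using (sum-syntax; ∑-distrib-+; ∑-permute; sum-cong-≗)
open import Relation.Binary.PropositionalEquality
  using (_≡_; refl; sym; trans; cong; cong₂; subst; subst₂; module ≡-Reasoning)

open import Data.Integer as ℤ using (_⊖_; +≤+; +[1+_])
open import Data.Integer.Properties using (∣⊖∣-≤; ∣m⊖n∣≡∣n⊖m∣; ∣m⊝n∣≤m⊔n; [+m]-[+n]≡m⊖n; pos-*)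
open import Data.Integer.Solver using (module +-*-Solver)
open import Data.Rational using (toℚᵘ)
open import Data.Rational.Properties
  using (toℚᵘ-fromℚᵘ; toℚᵘ-homo-+; toℚᵘ-homo‿-; toℚᵘ-homo-*; toℚᵘ-homo-∣-∣; toℚᵘ-cancel-≤)
open import Data.Rational.Unnormalised as ℚᵘ using (mkℚᵘ; *≡*; *≤*; _≃_)
open import Data.Rational.Unnormalised.Properties as ℚᵘ
  using (≃-trans; ≃-sym; +-cong; -‿cong; *-cong; ∣-∣-cong; ≤-respˡ-≃; ≤-respʳ-≃)

∑-mono-≤ : ∀ {n} {f g : Fin n → ℕ} → (∀ v → f v ≤ g v) → ∑[ v < n ] f v ≤ ∑[ v < n ] g v
∑-mono-≤ {ℕ.zero}  f≤g = z≤n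
∑-mono-≤ {suc n}   f≤g = +-mono-≤ (f≤g zero) (∑-mono-≤ (λ v → f≤g (suc v)))

∑-≤-card : ∀ {n} {f : Fin n → ℕ} → (∀ v → f v ≤ 1) → ∑[ v < n ] f v ≤ n
∑-≤-card {ℕ.zero}  f≤1 = z≤n
∑-≤-card {suc n}   f≤1 = +-mono-≤ (f≤1 zero) (∑-≤-card (λ v → f≤1 (suc v)))

sum-tabulate : ∀ {n} (f : Fin n → ℕ) → List.sum (tabulate f) ≡ ∑[ v < n ] f v
sum-tabulate {ℕ.zero} f = refl
sum-tabulate {suc n}  f = cong (λ s → f zero + s) (sum-tabulate (λ v → f (suc v)))

iverson : Bool → ℕ
iverson true  = 1
iverson false = 0

iverson≤1 : ∀ b → iverson b ≤ 1
iverson≤1 true  = s≤s z≤n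
iverson≤1 false = z≤n

agreements : ∀ {n} → Permutation′ n → (Fin n → Bool) → ℕ
agreements {n} π α = ∑[ v < n ] iverson (not (α (π ⟨$⟩ˡ v) xor α v))

hamming : ∀ {n} → (Fin n → Bool) → (Fin n → Bool) → ℕ
hamming {n} α β = ∑[ v < n ] iverson (α v xor β v)

hamming-comm : ∀ {n} (α β : Fin n → Bool) → hamming α β ≡ hamming β α
hamming-comm α β = sum-cong-≗ (λ v → cong iverson (xor-comm (α v) (β v)))

agreements-≤-card : ∀ {n} (π : Permutation′ n) (α : Fin n → Bool) → agreements π α ≤ n
agreements-≤-card π α = ∑-≤-card (λ v → iverson≤1 _)

iverson-agree-≤ : ∀ a₁ a₂ b₁ b₂ →
  iverson (not (b₁ xor b₂)) ≤ iverson (not (a₁ xor a₂)) + iverson (a₁ xor b₁) + iverson (a₂ xor b₂)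
iverson-agree-≤ a₁ a₂ b₁ b₂ = ≤ᵇ⇒≤ _ _ (check a₁ a₂ b₁ b₂)
  where
  check : ∀ a₁ a₂ b₁ b₂ →
    T (iverson (not (b₁ xor b₂)) ≤ᵇ iverson (not (a₁ xor a₂)) + iverson (a₁ xor b₁) + iverson (a₂ xor b₂))
  check true  true  true  true  = tt
  check true  true  true  false = tt
  check true  true  false true  = tt
  check true  true  false false = tt
  check true  false true  true  = tt
  check true  false true  false = tt
  check true  false false true  = tt
  check true  false false false = tt
  check false true  true  true  = tt
  check false true  true  false = tt
  check false true  false true  = tt
  check false true  false false = tt
  check false false true  true  = tt
  check false false true  false = tt
  check false false false true  = tt
  check false false false false = tt

agreements-lipschitz : ∀ {n} (π : Permutation′ n) (α β : Fin n → Bool) →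
  agreements π β ≤ agreements π α + 2 ℕ.* hamming α β
agreements-lipschitz {n} π α β = ≤-trans (∑-mono-≤ pointwise) (≤-reflexive sum-split)
  where
  open ≡-Reasoning
  agreeα : Fin n → ℕ
  agreeα v = iverson (not (α (π ⟨$⟩ˡ v) xor α v))
  δ : Fin n → ℕ
  δ v = iverson (α v xor β v)
  pointwise : ∀ v → iverson (not (β (π ⟨$⟩ˡ v) xor β v)) ≤ agreeα v + δ (π ⟨$⟩ˡ v) + δ v
  pointwise v = iverson-agree-≤ (α (π ⟨$⟩ˡ v)) (α v) (β (π ⟨$⟩ˡ v)) (β v)
  sum-split : ∑[ v < n ] (agreeα v + δ (π ⟨$⟩ˡ v) + δ v) ≡ agreements π α + 2 ℕ.* hamming α β
  sum-split = begin
    ∑[ v < n ] (agreeα v + δ (π ⟨$⟩ˡ v) + δ v)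
      ≡⟨ ∑-distrib-+ (λ v → agreeα v + δ (π ⟨$⟩ˡ v)) δ ⟩
    ∑[ v < n ] (agreeα v + δ (π ⟨$⟩ˡ v)) + hamming α β
      ≡⟨ cong (λ s → s + hamming α β) (∑-distrib-+ agreeα (λ v → δ (π ⟨$⟩ˡ v))) ⟩
    agreements π α + ∑[ v < n ] δ (π ⟨$⟩ˡ v) + hamming α β
      ≡⟨ cong (λ s → agreements π α + s + hamming α β) (sym (∑-permute δ (flip π))) ⟩
    agreements π α + hamming α β + hamming α β
      ≡⟨ +-assoc (agreements π α) (hamming α β) (hamming α β) ⟩
    agreements π α + (hamming α β + hamming α β)
      ≡⟨ cong (λ s → agreements π α + (hamming α β + s)) (sym (+-identityʳ (hamming α β))) ⟩
    agreements π α + 2 ℕ.* hamming α β ∎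

selfOverlap : ∀ {n} → Permutation′ n → Subset n → ℕ
selfOverlap π A = ⟨ π · 𝟙 A , 𝟙 A ⟩ + ⟨ π · 𝟙 (∁ A) , 𝟙 (∁ A) ⟩

𝟙≡iverson : ∀ {n} (S : Subset n) v → 𝟙 S v ≡ iverson (lookup S v)
𝟙≡iverson S v with lookup S v
... | true  = refl
... | false = refl

𝟙-∁ : ∀ {n} (S : Subset n) v → 𝟙 (∁ S) v ≡ iverson (not (lookup S v))
𝟙-∁ S v = trans (𝟙≡iverson (∁ S) v) (cong iverson (lookup-map v not S))

⟨⟩≡∑ : ∀ {n} (f g : Fin n → ℕ) → ⟨ f , g ⟩ ≡ ∑[ v < n ] (f v ℕ.* g v)
⟨⟩≡∑ {n} f g = trans (cong List.sum (map-tabulate {n = n} (λ v → v) _)) (sum-tabulate {n} _)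

∣∣≡∑ : ∀ {n} (S : Subset n) → ∣ S ∣ ≡ ∑[ v < n ] iverson (lookup S v)
∣∣≡∑ []          = refl
∣∣≡∑ (true ∷ S)  = cong suc (∣∣≡∑ S)
∣∣≡∑ (false ∷ S) = ∣∣≡∑ S

iverson-agree : ∀ a b → iverson a ℕ.* iverson b + iverson (not a) ℕ.* iverson (not b) ≡ iverson (not (a xor b))
iverson-agree true  true  = refl
iverson-agree true  false = refl
iverson-agree false true  = refl
iverson-agree false false = refl

selfOverlap≡agreements : ∀ {n} (π : Permutation′ n) (A : Subset n) → selfOverlap π A ≡ agreements π (lookup A)
selfOverlap≡agreements {n} π A = begin
  selfOverlap π A
    ≡⟨ cong₂ _+_ (⟨⟩≡∑ (π · 𝟙 A) (𝟙 A)) (⟨⟩≡∑ (π · 𝟙 (∁ A)) (𝟙 (∁ A))) ⟩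
  ∑[ v < n ] (𝟙 A (π ⟨$⟩ˡ v) ℕ.* 𝟙 A v) + ∑[ v < n ] (𝟙 (∁ A) (π ⟨$⟩ˡ v) ℕ.* 𝟙 (∁ A) v)
    ≡⟨ sym (∑-distrib-+ {n} _ _) ⟩
  ∑[ v < n ] (𝟙 A (π ⟨$⟩ˡ v) ℕ.* 𝟙 A v + 𝟙 (∁ A) (π ⟨$⟩ˡ v) ℕ.* 𝟙 (∁ A) v)
    ≡⟨ sum-cong-≗ pointwise ⟩
  agreements π (lookup A) ∎
  where
  open ≡-Reasoning
  pointwise : ∀ v → 𝟙 A (π ⟨$⟩ˡ v) ℕ.* 𝟙 A v + 𝟙 (∁ A) (π ⟨$⟩ˡ v) ℕ.* 𝟙 (∁ A) v
                  ≡ iverson (not (lookup A (π ⟨$⟩ˡ v) xor lookup A v))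
  pointwise v = trans
    (cong₂ _+_ (cong₂ ℕ._*_ (𝟙≡iverson A (π ⟨$⟩ˡ v)) (𝟙≡iverson A v))
               (cong₂ ℕ._*_ (𝟙-∁ A (π ⟨$⟩ˡ v)) (𝟙-∁ A v)))
    (iverson-agree (lookup A (π ⟨$⟩ˡ v)) (lookup A v))

iverson-xor : ∀ a b → iverson (a ∧ not b) + iverson (not a ∧ b) ≡ iverson (a xor b)
iverson-xor true  true  = refl
iverson-xor true  false = refl
iverson-xor false true  = refl
iverson-xor false false = refl

symmetricDifference≡hamming : ∀ {n} (A B : Subset n) →
  ∣ A ∩ ∁ B ∣ + ∣ ∁ A ∩ B ∣ ≡ hamming (lookup A) (lookup B)
symmetricDifference≡hamming {n} A B = begin
  ∣ A ∩ ∁ B ∣ + ∣ ∁ A ∩ B ∣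
    ≡⟨ cong₂ _+_ (∣∣≡∑ (A ∩ ∁ B)) (∣∣≡∑ (∁ A ∩ B)) ⟩
  ∑[ v < n ] iverson (lookup (A ∩ ∁ B) v) + ∑[ v < n ] iverson (lookup (∁ A ∩ B) v)
    ≡⟨ sym (∑-distrib-+ {n} _ _) ⟩
  ∑[ v < n ] (iverson (lookup (A ∩ ∁ B) v) + iverson (lookup (∁ A ∩ B) v))
    ≡⟨ sum-cong-≗ pointwise ⟩
  hamming (lookup A) (lookup B) ∎
  where
  open ≡-Reasoning
  pointwise : ∀ v → iverson (lookup (A ∩ ∁ B) v) + iverson (lookup (∁ A ∩ B) v)
                  ≡ iverson (lookup A v xor lookup B v)
  pointwise v = trans
    (cong₂ _+_
      (cong iverson (trans (lookup-zipWith _ v A (∁ B)) (cong (lookup A v ∧_) (lookup-map v not B))))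
      (cong iverson (trans (lookup-zipWith _ v (∁ A) B) (cong (_∧ lookup B v) (lookup-map v not A)))))
    (iverson-xor (lookup A v) (lookup B v))

∣m⊖n∣≤o : ∀ {m n o} → m ≤ n + o → n ≤ m + o → ℤ.∣ m ⊖ n ∣ ≤ o
∣m⊖n∣≤o {m} {n} m≤n+o n≤m+o with ≤-total m n
... | inj₁ m≤n = subst (_≤ _) (sym (∣⊖∣-≤ m≤n)) (m≤n+o⇒m∸n≤o n m n≤m+o)
... | inj₂ n≤m = subst (_≤ _) (trans (sym (∣⊖∣-≤ n≤m)) (∣m⊖n∣≡∣n⊖m∣ n m))
                        (m≤n+o⇒m∸n≤o m n m≤n+o)

toℚᵘ-/ : ∀ i m → toℚᵘ (i / suc m) ≃ mkℚᵘ i m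
toℚᵘ-/ i m = toℚᵘ-fromℚᵘ (mkℚᵘ i m)

mkℚᵘ-sub : ∀ i j m → mkℚᵘ i m ℚᵘ.- mkℚᵘ j m ≃ mkℚᵘ (i ℤ.- j) m
mkℚᵘ-sub i j m = *≡* (solve 3 (λ i j d → (i :* d :+ :- j :* d) :* d := (i :- j) :* (d :* d)) refl i j +[1+ m ])
  where open +-*-Solver

toℚᵘ-∣/-/∣ : ∀ a b m → toℚᵘ (abs ((+ a) / suc m - (+ b) / suc m)) ≃ mkℚᵘ (+ ℤ.∣ a ⊖ b ∣) m
toℚᵘ-∣/-/∣ a b m = ≃-trans (toℚᵘ-homo-∣-∣ (x - y)) (∣-∣-cong (≃-trans toℚᵘ-difference mkℚᵘ-difference))
  where
  x = (+ a) / suc m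
  y = (+ b) / suc m
  toℚᵘ-difference : toℚᵘ (x - y) ≃ mkℚᵘ (+ a) m ℚᵘ.- mkℚᵘ (+ b) m
  toℚᵘ-difference = ≃-trans (toℚᵘ-homo-+ x (Data.Rational.- y))
    (+-cong (toℚᵘ-/ (+ a) m) (≃-trans (toℚᵘ-homo‿- y) (-‿cong (toℚᵘ-/ (+ b) m))))
  mkℚᵘ-difference : mkℚᵘ (+ a) m ℚᵘ.- mkℚᵘ (+ b) m ≃ mkℚᵘ (a ⊖ b) m
  mkℚᵘ-difference = subst (λ i → mkℚᵘ (+ a) m ℚᵘ.- mkℚᵘ (+ b) m ≃ mkℚᵘ i m)
                          ([+m]-[+n]≡m⊖n a b) (mkℚᵘ-sub (+ a) (+ b) m)

mkℚᵘ-square-≤ : ∀ k c d m → k ℕ.* k ℕ.≤ c ℕ.* d ℕ.* suc m →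
  mkℚᵘ (+ k) m ℚᵘ.* mkℚᵘ (+ k) m ℚᵘ.≤ mkℚᵘ (+ c) 0 ℚᵘ.* mkℚᵘ (+ d) m
mkℚᵘ-square-≤ k c d m k²≤cdn = *≤* (subst₂ ℤ._≤_
  (trans (pos-* (k ℕ.* k) (1 ℕ.* n)) (cong (ℤ._* + (1 ℕ.* n)) (pos-* k k)))
  (trans (pos-* (c ℕ.* d) (n ℕ.* n)) (cong₂ ℤ._*_ (pos-* c d) (pos-* n n)))
  (+≤+ (subst₂ ℕ._≤_ (cong (k ℕ.* k ℕ.*_) (sym (*-identityˡ n))) (*-assoc (c ℕ.* d) n n)
                     (*-monoˡ-≤ n k²≤cdn))))
  where n = suc m

square-∣/-/∣-≤ : ∀ {a b c d m} → a ≤ suc m → b ≤ suc m → a ≤ b + c ℕ.* d → b ≤ a + c ℕ.* d →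
  abs ((+ a) / suc m - (+ b) / suc m) * abs ((+ a) / suc m - (+ b) / suc m) ≤ℚ ((+ c) / 1) * ((+ d) / suc m)
square-∣/-/∣-≤ {a} {b} {c} {d} {m} a≤n b≤n a≤b+cd b≤a+cd = toℚᵘ-cancel-≤
  (≤-respˡ-≃ (≃-sym square) (≤-respʳ-≃ (≃-sym product) (mkℚᵘ-square-≤ k c d m k²≤cdn)))
  where
  k = ℤ.∣ a ⊖ b ∣
  δ = abs ((+ a) / suc m - (+ b) / suc m)
  k²≤cdn : k ℕ.* k ℕ.≤ c ℕ.* d ℕ.* suc m
  k²≤cdn = subst (k ℕ.* k ℕ.≤_) (*-comm (suc m) (c ℕ.* d))
    (*-mono-≤ (≤-trans (∣m⊝n∣≤m⊔n a b) (⊔-lub a≤n b≤n)) (∣m⊖n∣≤o a≤b+cd b≤a+cd))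
  square : toℚᵘ (δ * δ) ≃ mkℚᵘ (+ k) m ℚᵘ.* mkℚᵘ (+ k) m
  square = ≃-trans (toℚᵘ-homo-* δ δ) (*-cong (toℚᵘ-∣/-/∣ a b m) (toℚᵘ-∣/-/∣ a b m))
  product : toℚᵘ (((+ c) / 1) * ((+ d) / suc m)) ≃ mkℚᵘ (+ c) 0 ℚᵘ.* mkℚᵘ (+ d) m
  product = ≃-trans (toℚᵘ-homo-* ((+ c) / 1) ((+ d) / suc m)) (*-cong (toℚᵘ-/ (+ c) 0) (toℚᵘ-/ (+ d) m))

lemma4p5 : (n : ℕ) .{{_ : NonZero n}} → 2 ≤ n → (π : Permutation′ n) → (A B : Subset n) →
    abs (Sig π A - Sig π B) * abs (Sig π A - Sig π B)
      ≤ℚ ((+ 2) / 1) * ((+ (∣ A ∩ ∁ B ∣ + ∣ ∁ A ∩ B ∣)) / n)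
lemma4p5 (suc m) _ π A B =
  square-∣/-/∣-≤ {c = 2} {d = d} (selfOverlap-≤ A) (selfOverlap-≤ B) A-close B-close
  where
  d = ∣ A ∩ ∁ B ∣ + ∣ ∁ A ∩ B ∣
  selfOverlap-≤ : ∀ S → selfOverlap π S ≤ suc m
  selfOverlap-≤ S = subst (_≤ suc m) (sym (selfOverlap≡agreements π S)) (agreements-≤-card π (lookup S))
  B-close : selfOverlap π B ≤ selfOverlap π A + 2 ℕ.* d
  B-close rewrite selfOverlap≡agreements π A | selfOverlap≡agreements π B | symmetricDifference≡hamming A B
    = agreements-lipschitz π (lookup A) (lookup B)
  A-close : selfOverlap π A ≤ selfOverlap π B + 2 ℕ.* d
  A-close rewrite selfOverlap≡agreements π A | selfOverlap≡agreements π B | symmetricDifference≡hamming A B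
                | hamming-comm (lookup A) (lookup B)
    = agreements-lipschitz π (lookup B) (lookup A)
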